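{- Consider the problem (RecSMSP): given $n$ jobs $N=\{1,\dots,n\}$ with first-stage processing times $p_j\ge 0$, second-stage processing times $q_j\ge 0$, and an integer $\Delta\in\{0,\dots,n\}$, solve \[ \min\ \sum_{i\in N}\sum_{j\in N}p_j(n+1-i)x_{ij}+\sum_{i\in N}\sum_{j\in N}q_j(n+1-i)y_{ij}\quad\text{s.t. } \sum_{i\in N}\sum_{j\in N}x_{ij}y_{ij}\ge\Delta,\ \bm{x},\bm{y}\in\mathcal{X}. \] Let (UB-SMSP) be the same problem with the constraint replaced by $\sum_{i,j}x_{ij}y_{ij}=n$ (i.e. $\bm{x}=\bm{y}$), equivalently $\min_{\bm{x}\in\mathcal{X}}\sum_{i\in N}\sum_{j\in N}(p_j+q_j)(n+1-i)x_{ij}$. Then an optimal solution of (UB-SMSP) (taking $\bm{y}=\bm{x}$) is a feasible solution of (RecSMSP) whose objective value is at most twice the optimal value of (RecSMSP); i.e. it provides a 2-approximation to (RecSMSP).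
   Context: $\mathcal{X}$ denotes the set of $n\times n$ permutation matrices ($\bm{x}\in\{0,1\}^{n\times n}$ with every row and every column summing to $1$); $x_{ij}=1$ means job $j$ is in position $i$ of the first-stage schedule, $y_{ij}=1$ means job $j$ is in position $i$ of the second-stage schedule.
   Formalization: The processing times $p_j$ and $q_j$ are nonnegative rationals rather than nonnegative reals. -}

module Defs where

open import Data.Nat as ℕ using (ℕ; zero; suc; _∸_)
open import Data.Fin using (Fin; zero; suc; toℕ)
open import Data.Sum using (_⊎_)
open import Data.Product using (_×_)
open import Relation.Binary.PropositionalEquality using (_≡_)
open import Data.Rational as ℚ using (ℚ; 0ℚ; _+_; _*_)
open import Data.Integer using (+_)

sumℕ : ∀ {n} → (Fin n → ℕ) → ℕ
sumℕ {zero}  f = 0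
sumℕ {suc n} f = f zero ℕ.+ sumℕ (λ i → f (suc i))

sumℚ : ∀ {n} → (Fin n → ℚ) → ℚ
sumℚ {zero}  f = 0ℚ
sumℚ {suc n} f = f zero + sumℚ (λ i → f (suc i))

ℕ→ℚ : ℕ → ℚ
ℕ→ℚ k = (+ k) ℚ./ 1

-- n×n 0/1 matrices, indexed x i j : position i, job j (0-based).
Matrix : ℕ → Set
Matrix n = Fin n → Fin n → ℕ

IsPermMatrix : (n : ℕ) → Matrix n → Set
IsPermMatrix n x =
  (∀ i j → (x i j ≡ 0) ⊎ (x i j ≡ 1)) ×
  (∀ i → sumℕ (λ j → x i j) ≡ 1) ×
  (∀ j → sumℕ (λ i → x i j) ≡ 1)

-- Weight of (1-based) position i+1 : n + 1 - (i+1) = n - i.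
weight : (n : ℕ) → Fin n → ℕ
weight n i = n ∸ toℕ i

schedCost : (n : ℕ) → (Fin n → ℚ) → Matrix n → ℚ
schedCost n c x = sumℚ (λ i → sumℚ (λ j → c j * ℕ→ℚ (weight n i) * ℕ→ℚ (x i j)))

recObj : (n : ℕ) → (p q : Fin n → ℚ) → Matrix n → Matrix n → ℚ
recObj n p q x y = schedCost n p x + schedCost n q y

commonPos : (n : ℕ) → Matrix n → Matrix n → ℕ
commonPos n x y = sumℕ (λ i → sumℕ (λ j → x i j ℕ.* y i j))

ubObj : (n : ℕ) → (p q : Fin n → ℚ) → Matrix n → ℚ
ubObj n p q x = schedCost n (λ j → p j + q j) x

{-# OPTIONS --safe #-}

-- Let a j and b j be the weights n + 1 − i of the positions i of job j in two schedules x and y.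
-- Each is a permutation of 1, …, n, so at most k jobs have a j ≤ k, and hence at most 2 k jobs
-- have a j ⊓ b j ≤ k. Scheduling the jobs by decreasing a j ⊓ b j therefore gives every job j
-- a weight of at most 2 (a j ⊓ b j), so for p, q ≥ 0 this single schedule costs at most twice
-- Σ p j a j + Σ q j b j, the RecSMSP objective of (x, y). The optimal common schedule xs costs
-- no more than it.

module Submission where

open import Defs
open import Data.Nat using (ℕ; _≤_)
open import Data.Fin using (Fin)
open import Data.Product using (_×_)
open import Data.Rational using (ℚ; 0ℚ; _*_) renaming (_≤_ to _≤ℚ_)

open import Algebra.Bundles using (CommutativeMonoid)
import Algebra.Properties.CommutativeSemigroup as CommSemigroupProperties
open import Data.Bool.Base using (if_then_else_)
open import Data.Fin.Base using (zero; suc; toℕ; fromℕ<)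
open import Data.Fin.Properties
  using (_≟_; 0≢1+n; suc-injective; toℕ<n; toℕ-fromℕ<; toℕ-injective)
import Data.Integer.Base as ℤ
import Data.Integer.Properties as ℤP
open import Data.Nat.Base as ℕ using (zero; suc; _<_; _⊓_; _∸_; z≤n; s≤s)
import Data.Nat.Coprimality as Coprime
import Data.Nat.Properties as ℕP
open import Data.Nat.Properties using (_≤?_)
open import Data.Product using (Σ; _,_; proj₁; proj₂)
open import Data.Rational.Base as ℚ using (mkℚ; _+_)
import Data.Rational.Properties as ℚP
open import Data.Sum using (_⊎_; inj₁; inj₂)
open import Function.Base using (_∘_)
open import Function.Definitions using (Injective)
open import Level using (Level)
open import Relation.Binary.PropositionalEquality
open import Relation.Binary.Definitions using (tri<; tri≈; tri>)
open import Relation.Nullary using (¬_; contradiction)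
open import Relation.Nullary.Decidable using (Dec; yes; no; does; dec-true; dec-false)

ℕ→ℚ≡mkℚ : ∀ k → ℕ→ℚ k ≡ mkℚ (ℤ.+ k) 0 (Coprime.sym (Coprime.1-coprimeTo k))
ℕ→ℚ≡mkℚ k = ℚP.normalize-coprime (Coprime.sym (Coprime.1-coprimeTo k))

ℕ→ℚ-mono-≤ : ∀ {a b} → a ≤ b → ℕ→ℚ a ≤ℚ ℕ→ℚ b
ℕ→ℚ-mono-≤ {a} {b} a≤b = subst₂ _≤ℚ_ (sym (ℕ→ℚ≡mkℚ a)) (sym (ℕ→ℚ≡mkℚ b))
  (ℚ.*≤* (ℤP.*-monoʳ-≤-nonNeg (ℤ.+ 1) (ℤ.+≤+ a≤b)))

ℕ→ℚ-homo-* : ∀ a b → ℕ→ℚ (a ℕ.* b) ≡ ℕ→ℚ a * ℕ→ℚ b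
ℕ→ℚ-homo-* a b =
  trans (cong (ℚ._/ 1) (ℤP.pos-* a b)) (sym (cong₂ _*_ (ℕ→ℚ≡mkℚ a) (ℕ→ℚ≡mkℚ b)))

private
  variable
    ℓ ℓ′ : Level
    A : Set ℓ
    B : Set ℓ′

-- Defined through does, so that 𝟙 (suc i ≟ suc j) computes to 𝟙 (i ≟ j).
𝟙 : Dec A → ℕ
𝟙 A? = if does A? then 1 else 0

𝟙-yes : (A? : Dec A) → A → 𝟙 A? ≡ 1
𝟙-yes A? x = cong (λ b → if b then 1 else 0) (dec-true A? x)

𝟙-no : (A? : Dec A) → ¬ A → 𝟙 A? ≡ 0
𝟙-no A? ¬x = cong (λ b → if b then 1 else 0) (dec-false A? ¬x)

𝟙≤1 : (A? : Dec A) → 𝟙 A? ≤ 1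
𝟙≤1 (yes _) = ℕP.≤-refl
𝟙≤1 (no _)  = z≤n

𝟙≡0∨𝟙≡1 : (A? : Dec A) → 𝟙 A? ≡ 0 ⊎ 𝟙 A? ≡ 1
𝟙≡0∨𝟙≡1 (yes _) = inj₂ refl
𝟙≡0∨𝟙≡1 (no _)  = inj₁ refl

𝟙-mono : (A? : Dec A) (B? : Dec B) → (A → B) → 𝟙 A? ≤ 𝟙 B?
𝟙-mono (yes x) B? A⇒B = ℕP.≤-reflexive (sym (𝟙-yes B? (A⇒B x)))
𝟙-mono (no _)  B? A⇒B = z≤n

private
  module ℕ+ = CommSemigroupProperties ℕP.+-commutativeSemigroup
  module ℚ+ = CommSemigroupProperties
    (CommutativeMonoid.commutativeSemigroup ℚP.+-0-commutativeMonoid)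
  module ℚ* = CommSemigroupProperties
    (CommutativeMonoid.commutativeSemigroup ℚP.*-1-commutativeMonoid)

sumℕ-cong : ∀ {n} {f g : Fin n → ℕ} → (∀ i → f i ≡ g i) → sumℕ f ≡ sumℕ g
sumℕ-cong {zero}  f≗g = refl
sumℕ-cong {suc n} f≗g = cong₂ ℕ._+_ (f≗g zero) (sumℕ-cong (f≗g ∘ suc))

sumℕ-mono-≤ : ∀ {n} {f g : Fin n → ℕ} → (∀ i → f i ≤ g i) → sumℕ f ≤ sumℕ g
sumℕ-mono-≤ {zero}  f≤g = z≤n
sumℕ-mono-≤ {suc n} f≤g = ℕP.+-mono-≤ (f≤g zero) (sumℕ-mono-≤ (f≤g ∘ suc))

sumℕ-mono-< : ∀ {n} {f g : Fin n → ℕ} → (∀ i → f i ≤ g i) →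
              ∀ k → f k < g k → sumℕ f < sumℕ g
sumℕ-mono-< f≤g zero    fk<gk = ℕP.+-mono-<-≤ fk<gk (sumℕ-mono-≤ (f≤g ∘ suc))
sumℕ-mono-< f≤g (suc k) fk<gk = ℕP.+-mono-≤-< (f≤g zero) (sumℕ-mono-< (f≤g ∘ suc) k fk<gk)

sumℕ-zero : ∀ n → sumℕ {n} (λ _ → 0) ≡ 0
sumℕ-zero zero    = refl
sumℕ-zero (suc n) = sumℕ-zero n

sumℕ-one : ∀ n → sumℕ {n} (λ _ → 1) ≡ n
sumℕ-one zero    = refl
sumℕ-one (suc n) = cong suc (sumℕ-one n)

sumℕ≡0⇒≡0 : ∀ {n} (f : Fin n → ℕ) → sumℕ f ≡ 0 → ∀ i → f i ≡ 0
sumℕ≡0⇒≡0 f Σf≡0 zero    = ℕP.m+n≡0⇒m≡0 (f zero) Σf≡0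
sumℕ≡0⇒≡0 f Σf≡0 (suc i) = sumℕ≡0⇒≡0 (f ∘ suc) (ℕP.m+n≡0⇒n≡0 (f zero) Σf≡0) i

term≤sumℕ : ∀ {n} (f : Fin n → ℕ) k → f k ≤ sumℕ f
term≤sumℕ f zero    = ℕP.m≤m+n (f zero) _
term≤sumℕ f (suc k) = ℕP.≤-trans (term≤sumℕ (f ∘ suc) k) (ℕP.m≤n+m _ (f zero))

sumℕ-distrib-+ : ∀ {n} (f g : Fin n → ℕ) → sumℕ (λ i → f i ℕ.+ g i) ≡ sumℕ f ℕ.+ sumℕ g
sumℕ-distrib-+ {zero}  f g = refl
sumℕ-distrib-+ {suc n} f g =
  trans (cong (f zero ℕ.+ g zero ℕ.+_) (sumℕ-distrib-+ (f ∘ suc) (g ∘ suc)))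
        (ℕ+.interchange (f zero) (g zero) _ _)

sumℕ-comm : ∀ {m n} (f : Fin m → Fin n → ℕ) →
  sumℕ (λ i → sumℕ (f i)) ≡ sumℕ (λ j → sumℕ (λ i → f i j))
sumℕ-comm {zero}  {n} f = sym (sumℕ-zero n)
sumℕ-comm {suc m} f = trans (cong (sumℕ (f zero) ℕ.+_) (sumℕ-comm (f ∘ suc)))
  (sym (sumℕ-distrib-+ (f zero) (λ j → sumℕ (λ i → f (suc i) j))))

sumℕ-distribʳ-* : ∀ {n} (f : Fin n → ℕ) c → sumℕ (λ i → f i ℕ.* c) ≡ sumℕ f ℕ.* c
sumℕ-distribʳ-* {zero}  f c = refl
sumℕ-distribʳ-* {suc n} f c = trans (cong (f zero ℕ.* c ℕ.+_) (sumℕ-distribʳ-* (f ∘ suc) c))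
  (sym (ℕP.*-distribʳ-+ c (f zero) _))

sumℕ-select : ∀ {n} (g : Fin n → ℕ) k → sumℕ (λ i → 𝟙 (i ≟ k) ℕ.* g i) ≡ g k
sumℕ-select {suc n} g zero    = trans (cong₂ ℕ._+_ (ℕP.+-identityʳ (g zero)) (sumℕ-zero n))
  (ℕP.+-identityʳ (g zero))
sumℕ-select {suc n} g (suc k) = sumℕ-select (g ∘ suc) k

sumℕ-≤1⇒≤n : ∀ {n} (f : Fin n → ℕ) → (∀ i → f i ≤ 1) → sumℕ f ≤ n
sumℕ-≤1⇒≤n {n} f f≤1 = subst (sumℕ f ≤_) (sumℕ-one n) (sumℕ-mono-≤ f≤1)

≤1∧sumℕ≡n⇒≡1 : ∀ {n} (f : Fin n → ℕ) → (∀ i → f i ≤ 1) → sumℕ f ≡ n →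
               ∀ i → f i ≡ 1
≤1∧sumℕ≡n⇒≡1 {n} f f≤1 Σf≡n i with ℕP.m≤n⇒m<n∨m≡n (f≤1 i)
... | inj₂ fi≡1 = fi≡1
... | inj₁ fi<1 = contradiction Σf≡n (ℕP.<⇒≢ Σf<n)
  where
  Σf<n : sumℕ f < n
  Σf<n = subst (sumℕ f <_) (sumℕ-one n) (sumℕ-mono-< f≤1 i fi<1)

sumℚ-cong : ∀ {n} {f g : Fin n → ℚ} → (∀ i → f i ≡ g i) → sumℚ f ≡ sumℚ g
sumℚ-cong {zero}  f≗g = refl
sumℚ-cong {suc n} f≗g = cong₂ _+_ (f≗g zero) (sumℚ-cong (f≗g ∘ suc))

sumℚ-mono-≤ : ∀ {n} {f g : Fin n → ℚ} → (∀ i → f i ≤ℚ g i) → sumℚ f ≤ℚ sumℚ g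
sumℚ-mono-≤ {zero}  f≤g = ℚP.≤-refl
sumℚ-mono-≤ {suc n} f≤g = ℚP.+-mono-≤ (f≤g zero) (sumℚ-mono-≤ (f≤g ∘ suc))

sumℚ-zero : ∀ n → sumℚ {n} (λ _ → 0ℚ) ≡ 0ℚ
sumℚ-zero zero    = refl
sumℚ-zero (suc n) = trans (ℚP.+-identityˡ _) (sumℚ-zero n)

sumℚ-distrib-+ : ∀ {n} (f g : Fin n → ℚ) → sumℚ (λ i → f i + g i) ≡ sumℚ f + sumℚ g
sumℚ-distrib-+ {zero}  f g = refl
sumℚ-distrib-+ {suc n} f g =
  trans (cong (f zero + g zero +_) (sumℚ-distrib-+ (f ∘ suc) (g ∘ suc)))
        (ℚ+.interchange (f zero) (g zero) _ _)

sumℚ-comm : ∀ {m n} (f : Fin m → Fin n → ℚ) →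
  sumℚ (λ i → sumℚ (f i)) ≡ sumℚ (λ j → sumℚ (λ i → f i j))
sumℚ-comm {zero}  {n} f = sym (sumℚ-zero n)
sumℚ-comm {suc m} f = trans (cong (sumℚ (f zero) +_) (sumℚ-comm (f ∘ suc)))
  (sym (sumℚ-distrib-+ (f zero) (λ j → sumℚ (λ i → f (suc i) j))))

sumℚ-distribˡ-* : ∀ {n} c (f : Fin n → ℚ) → sumℚ (λ i → c * f i) ≡ c * sumℚ f
sumℚ-distribˡ-* {zero}  c f = sym (ℚP.*-zeroʳ c)
sumℚ-distribˡ-* {suc n} c f = trans (cong (c * f zero +_) (sumℚ-distribˡ-* c (f ∘ suc)))
  (sym (ℚP.*-distribˡ-+ c (f zero) _))

sumℚ-select : ∀ {n} (f : Fin n → ℚ) k → sumℚ (λ i → f i * ℕ→ℚ (𝟙 (i ≟ k))) ≡ f k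
sumℚ-select {suc n} f zero = begin
  f zero * ℚ.1ℚ + sumℚ (λ i → f (suc i) * 0ℚ)
    ≡⟨ cong₂ _+_ (ℚP.*-identityʳ (f zero))
                 (trans (sumℚ-cong (ℚP.*-zeroʳ ∘ f ∘ suc)) (sumℚ-zero n)) ⟩
  f zero + 0ℚ
    ≡⟨ ℚP.+-identityʳ (f zero) ⟩
  f zero ∎
  where open ≡-Reasoning
sumℚ-select {suc n} f (suc k) = begin
  f zero * 0ℚ + rest ≡⟨ cong (_+ rest) (ℚP.*-zeroʳ (f zero)) ⟩
  0ℚ + rest          ≡⟨ ℚP.+-identityˡ rest ⟩
  rest               ≡⟨ sumℚ-select (f ∘ suc) k ⟩
  f (suc k)          ∎
  where
  open ≡-Reasoning
  rest = sumℚ (λ i → f (suc i) * ℕ→ℚ (𝟙 (i ≟ k)))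

count≤ : ∀ {n} → (Fin n → ℕ) → ℕ → ℕ
count≤ f k = sumℕ (λ j → 𝟙 (f j ≤? k))

count≤≤n : ∀ {n} (f : Fin n → ℕ) k → count≤ f k ≤ n
count≤≤n f k = sumℕ-≤1⇒≤n _ (λ j → 𝟙≤1 (f j ≤? k))

count≤-⊓ : ∀ {n} (a b : Fin n → ℕ) k →
  count≤ (λ j → a j ⊓ b j) k ≤ count≤ a k ℕ.+ count≤ b k
count≤-⊓ a b k = ℕP.≤-trans (sumℕ-mono-≤ split)
  (ℕP.≤-reflexive (sumℕ-distrib-+ (λ j → 𝟙 (a j ≤? k)) (λ j → 𝟙 (b j ≤? k))))
  where
  split : ∀ j → 𝟙 (a j ⊓ b j ≤? k) ≤ 𝟙 (a j ≤? k) ℕ.+ 𝟙 (b j ≤? k)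
  split j with ℕP.⊓-sel (a j) (b j)
  ... | inj₁ ⊓≡a = ℕP.≤-trans (𝟙-mono (a j ⊓ b j ≤? k) (a j ≤? k) (subst (_≤ k) ⊓≡a))
                              (ℕP.m≤m+n _ _)
  ... | inj₂ ⊓≡b = ℕP.≤-trans (𝟙-mono (a j ⊓ b j ≤? k) (b j ≤? k) (subst (_≤ k) ⊓≡b))
                              (ℕP.m≤n+m _ _)

-- The weights of Fin (suc n) are suc n followed, definitionally, by the weights of Fin n.
count≤-weight : ∀ n k → count≤ (weight n) k ≤ k
count≤-weight zero    k = z≤n
count≤-weight (suc n) k with suc n ≤? k
... | yes n<k = ℕP.≤-trans (ℕP.+-mono-≤ (𝟙≤1 (suc n ≤? k)) (count≤≤n (weight n) k)) n<k
... | no  n≮k = ℕP.≤-trans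
  (ℕP.≤-reflexive (cong (ℕ._+ count≤ (weight n) k) (𝟙-no (suc n ≤? k) n≮k)))
  (count≤-weight n k)

Sparse : ∀ {n} → ℕ → (Fin n → ℕ) → Set
Sparse c f = ∀ k → count≤ f k ≤ c ℕ.* k

⊓-sparse : ∀ {n c d} {a b : Fin n → ℕ} → Sparse c a → Sparse d b →
           Sparse (c ℕ.+ d) (λ j → a j ⊓ b j)
⊓-sparse {c = c} {d} {a} {b} a-sparse b-sparse k = begin
  count≤ (λ j → a j ⊓ b j) k    ≤⟨ count≤-⊓ a b k ⟩
  count≤ a k ℕ.+ count≤ b k     ≤⟨ ℕP.+-mono-≤ (a-sparse k) (b-sparse k) ⟩
  c ℕ.* k ℕ.+ d ℕ.* k           ≡⟨ ℕP.*-distribʳ-+ k c d ⟨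
  (c ℕ.+ d) ℕ.* k               ∎
  where open ℕP.≤-Reasoning

module Ranking {n} (key : Fin n → ℕ) (key-injective : Injective _≡_ _≡_ key) where

  rank : Fin n → ℕ
  rank j = count≤ key (key j)

  1≤rank : ∀ j → 1 ≤ rank j
  1≤rank j = subst (_≤ rank j) (𝟙-yes (key j ≤? key j) ℕP.≤-refl) (term≤sumℕ _ j)

  rank≤n : ∀ j → rank j ≤ n
  rank≤n j = count≤≤n key (key j)

  rank-mono-< : ∀ {i j} → key i < key j → rank i < rank j
  rank-mono-< {i} {j} kᵢ<kⱼ = sumℕ-mono-< below-i⇒below-j j
    (subst₂ _<_ (sym (𝟙-no (key j ≤? key i) (ℕP.<⇒≱ kᵢ<kⱼ)))
                (sym (𝟙-yes (key j ≤? key j) ℕP.≤-refl))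
                ℕP.≤-refl)
    where
    below-i⇒below-j : ∀ l → 𝟙 (key l ≤? key i) ≤ 𝟙 (key l ≤? key j)
    below-i⇒below-j l = 𝟙-mono (key l ≤? key i) (key l ≤? key j)
      (λ kₗ≤kᵢ → ℕP.≤-trans kₗ≤kᵢ (ℕP.<⇒≤ kᵢ<kⱼ))

  rank-injective : Injective _≡_ _≡_ rank
  rank-injective {i} {j} rᵢ≡rⱼ with ℕP.<-cmp (key i) (key j)
  ... | tri< kᵢ<kⱼ _ _ = contradiction rᵢ≡rⱼ (ℕP.<⇒≢ (rank-mono-< kᵢ<kⱼ))
  ... | tri≈ _ kᵢ≡kⱼ _ = key-injective kᵢ≡kⱼ
  ... | tri> _ _ kⱼ<kᵢ = contradiction (sym rᵢ≡rⱼ) (ℕP.<⇒≢ (rank-mono-< kⱼ<kᵢ))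

  n∸rank<n : ∀ j → n ∸ rank j < n
  n∸rank<n j = ℕP.∸-monoʳ-< {n} {rank j} {0} (1≤rank j) (rank≤n j)

  slot : Fin n → Fin n
  slot j = fromℕ< (n∸rank<n j)

  weight-slot : ∀ j → weight n (slot j) ≡ rank j
  weight-slot j = trans (cong (n ∸_) (toℕ-fromℕ< (n∸rank<n j))) (ℕP.m∸[m∸n]≡n (rank≤n j))

  slot-injective : Injective _≡_ _≡_ slot
  slot-injective {i} {j} sᵢ≡sⱼ =
    rank-injective (trans (sym (weight-slot i)) (trans (cong (weight n) sᵢ≡sⱼ) (weight-slot j)))

lexKey : ∀ {n} → (Fin n → ℕ) → Fin n → ℕ
lexKey {n} m j = m j ℕ.* n ℕ.+ toℕ j

module _ {n} (m : Fin n → ℕ) where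

  lexKey-mono-< : ∀ {i j} → m i < m j → lexKey m i < lexKey m j
  lexKey-mono-< {i} {j} mᵢ<mⱼ = begin-strict
    m i ℕ.* n ℕ.+ toℕ i  <⟨ ℕP.+-monoʳ-< (m i ℕ.* n) (toℕ<n i) ⟩
    m i ℕ.* n ℕ.+ n      ≡⟨ ℕP.+-comm (m i ℕ.* n) n ⟩
    suc (m i) ℕ.* n      ≤⟨ ℕP.*-monoˡ-≤ n mᵢ<mⱼ ⟩
    m j ℕ.* n            ≤⟨ ℕP.m≤m+n (m j ℕ.* n) (toℕ j) ⟩
    lexKey m j           ∎
    where open ℕP.≤-Reasoning

  lexKey-reflects-≤ : ∀ {i j} → lexKey m i ≤ lexKey m j → m i ≤ m j
  lexKey-reflects-≤ kᵢ≤kⱼ = ℕP.≮⇒≥ (λ mⱼ<mᵢ → ℕP.<⇒≱ (lexKey-mono-< mⱼ<mᵢ) kᵢ≤kⱼ)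

  lexKey-injective : Injective _≡_ _≡_ (lexKey m)
  lexKey-injective {i} {j} kᵢ≡kⱼ = toℕ-injective (ℕP.+-cancelˡ-≡ (m i ℕ.* n) _ _
    (trans kᵢ≡kⱼ (cong (λ t → t ℕ.* n ℕ.+ toℕ j) (sym mᵢ≡mⱼ))))
    where
    mᵢ≡mⱼ : m i ≡ m j
    mᵢ≡mⱼ = ℕP.≤-antisym (lexKey-reflects-≤ (ℕP.≤-reflexive kᵢ≡kⱼ))
                         (lexKey-reflects-≤ (ℕP.≤-reflexive (sym kᵢ≡kⱼ)))

sparse⇒schedule : ∀ {n c} {m : Fin n → ℕ} → Sparse c m →
  Σ (Fin n → Fin n) λ σ → Injective _≡_ _≡_ σ × (∀ j → weight n (σ j) ≤ c ℕ.* m j)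
sparse⇒schedule {n} {c} {m} m-sparse = slot , slot-injective , weight-slot≤
  where
  open Ranking (lexKey m) (lexKey-injective m)
  weight-slot≤ : ∀ j → weight n (slot j) ≤ c ℕ.* m j
  weight-slot≤ j = begin
    weight n (slot j)  ≡⟨ weight-slot j ⟩
    rank j             ≤⟨ sumℕ-mono-≤ (λ i → 𝟙-mono (lexKey m i ≤? lexKey m j) (m i ≤? m j)
                                                   (lexKey-reflects-≤ m)) ⟩
    count≤ m (m j)     ≤⟨ m-sparse (m j) ⟩
    c ℕ.* m j          ∎
    where open ℕP.≤-Reasoning

matrixOf : ∀ {n} → (Fin n → Fin n) → Matrix n
matrixOf π i j = 𝟙 (i ≟ π j)

IsPermMatrix-resp-≗ : ∀ {n} {x y : Matrix n} → (∀ i j → x i j ≡ y i j) →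
                      IsPermMatrix n x → IsPermMatrix n y
IsPermMatrix-resp-≗ {n} {x} {y} x≗y (binary , rows , columns) =
  (λ i j → subst (λ e → e ≡ 0 ⊎ e ≡ 1) (x≗y i j) (binary i j)) ,
  (λ i → trans (sumℕ-cong (λ j → sym (x≗y i j))) (rows i)) ,
  (λ j → trans (sumℕ-cong (λ i → sym (x≗y i j))) (columns j))

sumℕ≡1⇒unit : ∀ {n} (f : Fin n → ℕ) → (∀ i → f i ≡ 0 ⊎ f i ≡ 1) → sumℕ f ≡ 1 →
  Σ (Fin n) λ k → ∀ i → f i ≡ 𝟙 (i ≟ k)
sumℕ≡1⇒unit {suc n} f binary Σf≡1 with binary zero
... | inj₂ f₀≡1 = zero , λ { zero → f₀≡1 ; (suc i) → sumℕ≡0⇒≡0 (f ∘ suc) rest≡0 i }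
  where
  rest≡0 : sumℕ (f ∘ suc) ≡ 0
  rest≡0 = ℕP.+-cancelˡ-≡ 1 _ _ (trans (cong (ℕ._+ sumℕ (f ∘ suc)) (sym f₀≡1)) Σf≡1)
... | inj₁ f₀≡0
  with sumℕ≡1⇒unit (f ∘ suc) (binary ∘ suc) (trans (cong (ℕ._+ sumℕ (f ∘ suc)) (sym f₀≡0)) Σf≡1)
... | k , unit = suc k , λ { zero → f₀≡0 ; (suc i) → unit i }

permMatrix⇒matrixOf : ∀ {n} {x : Matrix n} → IsPermMatrix n x →
  Σ (Fin n → Fin n) λ π → IsPermMatrix n (matrixOf π) × (∀ i j → x i j ≡ matrixOf π i j)
permMatrix⇒matrixOf {x = x} x-perm@(binary , _ , columns) = π , IsPermMatrix-resp-≗ x≗π x-perm , x≗π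
  where
  unit = λ j → sumℕ≡1⇒unit (λ i → x i j) (λ i → binary i j) (columns j)
  π = λ j → proj₁ (unit j)
  x≗π = λ i j → proj₂ (unit j) i

injective⇒fibre≤1 : ∀ {m n} {σ : Fin m → Fin n} → Injective _≡_ _≡_ σ →
  ∀ i → sumℕ (λ j → 𝟙 (i ≟ σ j)) ≤ 1
injective⇒fibre≤1 {zero}          σ-inj i = z≤n
injective⇒fibre≤1 {suc m} {σ = σ} σ-inj i with i ≟ σ zero
... | yes i≡σ₀ = s≤s (ℕP.≤-reflexive (trans (sumℕ-cong others) (sumℕ-zero m)))
  where
  others : ∀ j → 𝟙 (i ≟ σ (suc j)) ≡ 0
  others j = 𝟙-no (i ≟ σ (suc j)) (λ i≡σⱼ₊₁ → 0≢1+n (σ-inj (trans (sym i≡σ₀) i≡σⱼ₊₁)))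
... | no _ = injective⇒fibre≤1 (λ e → suc-injective (σ-inj e)) i

matrixOf-isPerm : ∀ {n} {σ : Fin n → Fin n} → Injective _≡_ _≡_ σ → IsPermMatrix n (matrixOf σ)
matrixOf-isPerm {n} {σ} σ-inj = (λ i j → 𝟙≡0∨𝟙≡1 (i ≟ σ j)) , rows , columns
  where
  columns : ∀ j → sumℕ (λ i → matrixOf σ i j) ≡ 1
  columns j = trans (sumℕ-cong (λ i → sym (ℕP.*-identityʳ (𝟙 (i ≟ σ j)))))
                    (sumℕ-select (λ _ → 1) (σ j))
  total : sumℕ (λ i → sumℕ (matrixOf σ i)) ≡ n
  total = trans (sumℕ-comm (matrixOf σ)) (trans (sumℕ-cong columns) (sumℕ-one n))
  rows : ∀ i → sumℕ (matrixOf σ i) ≡ 1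
  rows = ≤1∧sumℕ≡n⇒≡1 _ (injective⇒fibre≤1 σ-inj) total

sumℕ-reindex : ∀ {n} {π : Fin n → Fin n} → IsPermMatrix n (matrixOf π) →
  (h : Fin n → ℕ) → sumℕ (h ∘ π) ≡ sumℕ h
sumℕ-reindex {π = π} (_ , rows , _) h = begin
  sumℕ (h ∘ π)
    ≡⟨ sumℕ-cong (λ j → sumℕ-select h (π j)) ⟨
  sumℕ (λ j → sumℕ (λ i → matrixOf π i j ℕ.* h i))
    ≡⟨ sumℕ-comm (λ i j → matrixOf π i j ℕ.* h i) ⟨
  sumℕ (λ i → sumℕ (λ j → matrixOf π i j ℕ.* h i))
    ≡⟨ sumℕ-cong (λ i → sumℕ-distribʳ-* (matrixOf π i) (h i)) ⟩
  sumℕ (λ i → sumℕ (matrixOf π i) ℕ.* h i)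
    ≡⟨ sumℕ-cong (λ i → trans (cong (ℕ._* h i) (rows i)) (ℕP.*-identityˡ (h i))) ⟩
  sumℕ h ∎
  where open ≡-Reasoning

weight-sparse : ∀ {n} {π : Fin n → Fin n} → IsPermMatrix n (matrixOf π) → Sparse 1 (weight n ∘ π)
weight-sparse {n} {π} π-perm k = begin
  count≤ (weight n ∘ π) k  ≡⟨ sumℕ-reindex π-perm (λ i → 𝟙 (weight n i ≤? k)) ⟩
  count≤ (weight n) k      ≤⟨ count≤-weight n k ⟩
  k                        ≡⟨ ℕP.*-identityˡ k ⟨
  1 ℕ.* k                  ∎
  where open ℕP.≤-Reasoning

schedule-within-twice : ∀ {n} {π τ : Fin n → Fin n} →
  IsPermMatrix n (matrixOf π) → IsPermMatrix n (matrixOf τ) →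
  Σ (Fin n → Fin n) λ σ → Injective _≡_ _≡_ σ ×
    (∀ j → weight n (σ j) ≤ 2 ℕ.* weight n (π j)) × (∀ j → weight n (σ j) ≤ 2 ℕ.* weight n (τ j))
schedule-within-twice {n} {π} {τ} π-perm τ-perm =
  let σ , σ-inj , σ≤2m = sparse⇒schedule {c = 2} {m} m-sparse in
  σ , σ-inj , (λ j → ℕP.≤-trans (σ≤2m j) (ℕP.*-monoʳ-≤ 2 (ℕP.m⊓n≤m (a j) (b j)))) ,
              (λ j → ℕP.≤-trans (σ≤2m j) (ℕP.*-monoʳ-≤ 2 (ℕP.m⊓n≤n (a j) (b j))))
  where
  a b m : Fin n → ℕ
  a = weight n ∘ π
  b = weight n ∘ τ
  m j = a j ⊓ b j
  m-sparse : Sparse 2 m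
  m-sparse = ⊓-sparse {c = 1} {1} {a} {b} (weight-sparse π-perm) (weight-sparse τ-perm)

schedCost-cong : ∀ {n} (c : Fin n → ℚ) {x y : Matrix n} → (∀ i j → x i j ≡ y i j) →
  schedCost n c x ≡ schedCost n c y
schedCost-cong {n} c x≗y =
  sumℚ-cong (λ i → sumℚ-cong (λ j → cong (λ e → c j * ℕ→ℚ (weight n i) * ℕ→ℚ e) (x≗y i j)))

schedCost-matrixOf : ∀ {n} (c : Fin n → ℚ) (π : Fin n → Fin n) →
  schedCost n c (matrixOf π) ≡ sumℚ (λ j → c j * ℕ→ℚ (weight n (π j)))
schedCost-matrixOf {n} c π =
  trans (sumℚ-comm (λ i j → c j * ℕ→ℚ (weight n i) * ℕ→ℚ (matrixOf π i j)))
        (sumℚ-cong (λ j → sumℚ-select (λ i → c j * ℕ→ℚ (weight n i)) (π j)))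

schedCost-distrib-+ : ∀ {n} (p q : Fin n → ℚ) (x : Matrix n) →
  schedCost n (λ j → p j + q j) x ≡ schedCost n p x + schedCost n q x
schedCost-distrib-+ {n} p q x = begin
  sumℚ (λ i → sumℚ (λ j → (p j + q j) * w i * e i j))
    ≡⟨ sumℚ-cong (λ i → sumℚ-cong (distrib i)) ⟩
  sumℚ (λ i → sumℚ (λ j → P i j + Q i j))
    ≡⟨ sumℚ-cong (λ i → sumℚ-distrib-+ (P i) (Q i)) ⟩
  sumℚ (λ i → sumℚ (P i) + sumℚ (Q i))
    ≡⟨ sumℚ-distrib-+ (sumℚ ∘ P) (sumℚ ∘ Q) ⟩
  schedCost n p x + schedCost n q x ∎
  where
  open ≡-Reasoning
  w = ℕ→ℚ ∘ weight n
  e = λ i j → ℕ→ℚ (x i j)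
  P = λ i j → p j * w i * e i j
  Q = λ i j → q j * w i * e i j
  distrib : ∀ i j → (p j + q j) * w i * e i j ≡ P i j + Q i j
  distrib i j = trans (cong (_* e i j) (ℚP.*-distribʳ-+ (w i) (p j) (q j)))
    (ℚP.*-distribʳ-+ (e i j) (p j * w i) (q j * w i))

schedCost-≤-scaled : ∀ {n} {c : Fin n → ℚ} {σ π : Fin n → Fin n} k →
  (∀ j → 0ℚ ≤ℚ c j) →
  (∀ j → weight n (σ j) ≤ k ℕ.* weight n (π j)) →
  schedCost n c (matrixOf σ) ≤ℚ ℕ→ℚ k * schedCost n c (matrixOf π)
schedCost-≤-scaled {n} {c} {σ} {π} k c≥0 σ≤kπ = begin
  schedCost n c (matrixOf σ)         ≡⟨ schedCost-matrixOf c σ ⟩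
  sumℚ (λ j → c j * wσ j)            ≤⟨ sumℚ-mono-≤ pointwise ⟩
  sumℚ (λ j → ℕ→ℚ k * (c j * wπ j))  ≡⟨ sumℚ-distribˡ-* (ℕ→ℚ k) (λ j → c j * wπ j) ⟩
  ℕ→ℚ k * sumℚ (λ j → c j * wπ j)    ≡⟨ cong (ℕ→ℚ k *_) (schedCost-matrixOf c π) ⟨
  ℕ→ℚ k * schedCost n c (matrixOf π) ∎
  where
  open ℚP.≤-Reasoning
  wσ wπ : Fin n → ℚ
  wσ j = ℕ→ℚ (weight n (σ j))
  wπ j = ℕ→ℚ (weight n (π j))
  pointwise : ∀ j → c j * wσ j ≤ℚ ℕ→ℚ k * (c j * wπ j)
  pointwise j = begin
    c j * wσ j                       ≤⟨ ℚP.*-monoˡ-≤-nonNeg (c j) {{ℚ.nonNegative (c≥0 j)}}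
                                                            (ℕ→ℚ-mono-≤ (σ≤kπ j)) ⟩
    c j * ℕ→ℚ (k ℕ.* weight n (π j)) ≡⟨ cong (c j *_) (ℕ→ℚ-homo-* k (weight n (π j))) ⟩
    c j * (ℕ→ℚ k * wπ j)             ≡⟨ ℚ*.x∙yz≈y∙xz (c j) (ℕ→ℚ k) (wπ j) ⟩
    ℕ→ℚ k * (c j * wπ j)             ∎

ubObj-≤-twice-recObj : ∀ {n} {p q : Fin n → ℚ} → (∀ j → 0ℚ ≤ℚ p j) → (∀ j → 0ℚ ≤ℚ q j) →
  ∀ {x y} → IsPermMatrix n x → IsPermMatrix n y →
  Σ (Matrix n) λ z → IsPermMatrix n z × ubObj n p q z ≤ℚ ℕ→ℚ 2 * recObj n p q x y
ubObj-≤-twice-recObj {n} {p} {q} p≥0 q≥0 {x} {y} x-perm y-perm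
  with permMatrix⇒matrixOf x-perm | permMatrix⇒matrixOf y-perm
... | π , π-perm , x≗π | τ , τ-perm , y≗τ with schedule-within-twice π-perm τ-perm
... | σ , σ-inj , σ≤2π , σ≤2τ = matrixOf σ , matrixOf-isPerm σ-inj , (begin
  ubObj n p q (matrixOf σ)
    ≡⟨ schedCost-distrib-+ p q (matrixOf σ) ⟩
  schedCost n p (matrixOf σ) + schedCost n q (matrixOf σ)
    ≤⟨ ℚP.+-mono-≤ (schedCost-≤-scaled 2 p≥0 σ≤2π) (schedCost-≤-scaled 2 q≥0 σ≤2τ) ⟩
  ℕ→ℚ 2 * P + ℕ→ℚ 2 * Q
    ≡⟨ ℚP.*-distribˡ-+ (ℕ→ℚ 2) P Q ⟨
  ℕ→ℚ 2 * (P + Q)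
    ≡⟨ cong (ℕ→ℚ 2 *_) (cong₂ _+_ (schedCost-cong p x≗π) (schedCost-cong q y≗τ)) ⟨
  ℕ→ℚ 2 * recObj n p q x y ∎)
  where
  open ℚP.≤-Reasoning
  P = schedCost n p (matrixOf π)
  Q = schedCost n q (matrixOf τ)

commonPos-self : ∀ {n} {x : Matrix n} → IsPermMatrix n x → commonPos n x x ≡ n
commonPos-self {n} (binary , rows , _) =
  trans (sumℕ-cong (λ i → trans (sumℕ-cong (λ j → idem (binary i j))) (rows i))) (sumℕ-one n)
  where
  idem : ∀ {a} → a ≡ 0 ⊎ a ≡ 1 → a ℕ.* a ≡ a
  idem (inj₁ refl) = refl
  idem (inj₂ refl) = refl

theorem2 : (n : ℕ) (p q : Fin n → ℚ) →
             (∀ j → 0ℚ ≤ℚ p j) → (∀ j → 0ℚ ≤ℚ q j) →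
             (Δ : ℕ) → Δ ≤ n →
             (xs : Matrix n) → IsPermMatrix n xs →
             (∀ x → IsPermMatrix n x → ubObj n p q xs ≤ℚ ubObj n p q x) →
             (Δ ≤ commonPos n xs xs) ×
             (∀ x y → IsPermMatrix n x → IsPermMatrix n y → Δ ≤ commonPos n x y →
                recObj n p q xs xs ≤ℚ ℕ→ℚ 2 * recObj n p q x y)
theorem2 n p q p≥0 q≥0 Δ Δ≤n xs xs-perm xs-optimal =
  subst (Δ ≤_) (sym (commonPos-self xs-perm)) Δ≤n , twice-optimal
  where
  twice-optimal : ∀ x y → IsPermMatrix n x → IsPermMatrix n y → Δ ≤ commonPos n x y →
    recObj n p q xs xs ≤ℚ ℕ→ℚ 2 * recObj n p q x y
  twice-optimal x y x-perm y-perm _ =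
    let z , z-perm , z≤2xy = ubObj-≤-twice-recObj p≥0 q≥0 x-perm y-perm in begin
    recObj n p q xs xs  ≡⟨ schedCost-distrib-+ p q xs ⟨
    ubObj n p q xs      ≤⟨ xs-optimal z z-perm ⟩
    ubObj n p q z       ≤⟨ z≤2xy ⟩
    ℕ→ℚ 2 * recObj n p q x y ∎
    where open ℚP.≤-Reasoning
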